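{- Let $W = T[\ell_i..r_i]$ be a non-empty string and $W' = T[\ell_i+1..r_i]$ the string obtained by deleting its first symbol. Let $\mathit{lrs}$ and $\mathit{lrs}'$ be the longest repeating suffixes of $W$ and $W'$ respectively, and let $\mathit{lrp}$ be the longest repeating prefix of $W$. Suppose $\mathit{lrp}$ is non-empty. Then the following statements are equivalent: (1) $\mathit{lrs} \neq \mathit{lrs}'$; (2) $\mathit{lrs} = \mathit{lrp}$ and $\mathit{lrs}$ occurs exactly twice in $W$; (3) $\mathit{lrs}'$ is the suffix of $W$ (equivalently of $W'$) of length $|\mathit{lrs}|-1$; (4) in the suffix tree of $W$, the locus of $\mathit{lrp}$ lies on (the interior of) the edge leading to $\mathrm{leaf}(\ell_i)$; (5) in the suffix tree of $W$, the locus of $\mathit{lrs}$ lies on (the interior of) the edge leading to $\mathrm{leaf}(\ell_i)$.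
   Context: The suffix tree of a string $W$ is the compacted trie of all suffixes of $W$ (no terminal symbol appended); every non-root internal node is branching. Every substring of $W$ has a locus, which is either a node or a position strictly inside an edge. For $\ell_i \le k \le r_i$, $\mathrm{leaf}(k)$ is the leaf representing the suffix $T[k..r_i]$; $\mathrm{leaf}(\ell_i)$ represents $W$ itself. The longest repeating prefix (resp. suffix) of a string is its longest prefix (resp. suffix) occurring at least twice in it (occurrences may overlap); it may be empty. -}

module Defs where

open import Data.List using (List; []; _∷_; _++_; [_]; length)
open import Data.Nat using (ℕ; _≤_)
open import Data.Product using (Σ; ∃; ∃-syntax; _×_; _,_)
open import Data.Sum using (_⊎_)
open import Relation.Binary.PropositionalEquality using (_≡_; _≢_)
open import Relation.Nullary using (¬_)

module _ {A : Set} where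

  IsPrefix : List A → List A → Set
  IsPrefix u w = ∃[ y ] w ≡ u ++ y

  IsSuffix : List A → List A → Set
  IsSuffix u w = ∃[ x ] w ≡ x ++ u

  OccursAt : List A → List A → ℕ → Set
  OccursAt w u i = ∃[ x ] ∃[ y ] (length x ≡ i × w ≡ x ++ u ++ y)

  IsSubstring : List A → List A → Set
  IsSubstring w u = ∃[ i ] OccursAt w u i

  -- u occurs at least twice in w (overlaps allowed)
  Repeats : List A → List A → Set
  Repeats w u = ∃[ i ] ∃[ j ] (i ≢ j × OccursAt w u i × OccursAt w u j)

  OccursExactlyTwice : List A → List A → Set
  OccursExactlyTwice w u =
    ∃[ i ] ∃[ j ] (i ≢ j × OccursAt w u i × OccursAt w u j
                   × (∀ k → OccursAt w u k → k ≡ i ⊎ k ≡ j))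

  IsLRS : List A → List A → Set
  IsLRS w s = IsSuffix s w × Repeats w s
            × (∀ t → IsSuffix t w → Repeats w t → length t ≤ length s)

  IsLRP : List A → List A → Set
  IsLRP w p = IsPrefix p w × Repeats w p
            × (∀ t → IsPrefix t w → Repeats w t → length t ≤ length p)

  -- Suffix tree of w (compacted trie of all suffixes, no terminal).
  -- Each point of the trie is identified with the substring spelled
  -- from the root.  Explicit nodes are: the root ([]), the branching
  -- (right-branching) substrings, and the leaves (substrings with no
  -- right extension in w).
  IsBranching : List A → List A → Set
  IsBranching w u = ∃[ a ] ∃[ b ] (a ≢ b × IsSubstring w (u ++ [ a ])
                                         × IsSubstring w (u ++ [ b ]))

  IsLeaf : List A → List A → Set
  IsLeaf w u = IsSubstring w u × (∀ a → ¬ IsSubstring w (u ++ [ a ]))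

  IsNode : List A → List A → Set
  IsNode w u = u ≡ [] ⊎ IsBranching w u ⊎ IsLeaf w u

  -- The locus of u lies strictly inside the edge of the suffix tree of w
  -- that leads into node x: u is a substring that is not a node, u is a
  -- proper prefix of x, and there is no node strictly between u and x
  -- (any node v with u ⊑ v ⊑ x is x itself).
  LocusInsideEdgeTo : List A → List A → List A → Set
  LocusInsideEdgeTo w x u =
    IsSubstring w u × ¬ IsNode w u × IsNode w x
    × IsPrefix u x × u ≢ x
    × (∀ v → IsNode w v → IsPrefix u v → IsPrefix v x → v ≡ x)

  -- leaf(ℓ_i) is the leaf representing w itself.
  LocusOnLeafEdgeOfW : List A → List A → Set
  LocusOnLeafEdgeOfW w u = LocusInsideEdgeTo w w u

-- Write W = c ∷ W′.  Deleting c shortens the longest repeating suffix by at most one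
-- symbol, and the suffix changes exactly when it no longer repeats in W′, i.e. when it
-- has at most one occurrence away from position 0.  A repeating word with that property
-- occurs exactly at the two ends of W: it is a prefix, no longer prefix repeats, and
-- every right extension of it occurring in W is a prefix of W, so its locus lies on the
-- edge to leaf(ℓᵢ).  Conversely, if the longest repeating prefix is not right-branching
-- (which is the case when lrp or lrs has its locus on that edge), each of its later
-- occurrences is final: otherwise the symbol after it either equals the one after the
-- initial occurrence, giving a longer repeating prefix, or makes it branch.  So it is a
-- suffix of lrs, and a repetition of lrs in W′ would give it two distinct final occurrences.
module Submission where

open import Defs
open import Data.List using (List; []; _∷_; _++_; [_]; length)
open import Data.List.Properties
  using (length-++; length-++-≤ˡ; length-++-comm; ++-assoc; ++-identityʳ; ++-cancelˡ; ++-conicalˡ; ∷-injective)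
open import Data.Nat using (ℕ; zero; suc; _+_; _≤_; _<_; s≤s; z≤n)
open import Data.Nat.Properties
open import Data.Product using (∃-syntax; _×_; _,_; proj₁; proj₂; map₁)
open import Data.Sum using (_⊎_; inj₁; inj₂)
open import Data.Empty using (⊥; ⊥-elim)
open import Function using (_∘_)
open import Function.Bundles using (_⇔_; mk⇔)
open import Relation.Nullary using (¬_; yes; no)
open import Relation.Binary.PropositionalEquality hiding ([_])

private variable
  A : Set
  a c : A
  u v w p s s′ : List A
  i j m n r : ℕ

++-injective : (x x′ : List A) → length x ≡ length x′ → x ++ u ≡ x′ ++ v → x ≡ x′ × u ≡ v
++-injective []      []       _   eq = refl , eq
++-injective (a ∷ x) (_ ∷ x′) len eq with ∷-injective eq
... | refl , eq′ = map₁ (cong (a ∷_)) (++-injective x x′ (suc-injective len) eq′)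

++-split : (x x′ : List A) → length x ≤ length x′ → x ++ u ≡ x′ ++ v
         → ∃[ z ] (x′ ≡ x ++ z × u ≡ z ++ v)
++-split []      x′       _         eq = x′ , refl , eq
++-split (a ∷ x) (_ ∷ x′) (s≤s len) eq with ∷-injective eq
... | refl , eq′ with ++-split x x′ len eq′
...   | z , e₁ , e₂ = z , cong (a ∷_) e₁ , e₂

length-++-++ : (x u y : List A) → length (x ++ u ++ y) ≡ length x + length u + length y
length-++-++ x u y = begin
  length (x ++ u ++ y)              ≡⟨ length-++ x ⟩
  length x + length (u ++ y)        ≡⟨ cong (length x +_) (length-++ u) ⟩
  length x + (length u + length y)  ≡⟨ +-assoc (length x) (length u) (length y) ⟨
  length x + length u + length y    ∎
  where open ≡-Reasoning

occursAt-bound : OccursAt w u i → i + length u ≤ length w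
occursAt-bound {u = u} (x , y , refl , refl) =
  ≤-trans (m≤m+n _ (length y)) (≤-reflexive (sym (length-++-++ x u y)))

occursAt-extend : OccursAt w u i → i + length u < length w → ∃[ a ] OccursAt w (u ++ [ a ]) i
occursAt-extend {u = u} (x , [] , refl , refl) lt =
  ⊥-elim (<-irrefl (sym (trans (length-++-++ x u []) (+-identityʳ _))) lt)
occursAt-extend {u = u} (x , a ∷ y , len , eq) _ =
  a , x , y , len , trans eq (cong (x ++_) (sym (++-assoc u [ a ] y)))

occursAt-++ˡ : OccursAt w (u ++ v) i → OccursAt w u i
occursAt-++ˡ {u = u} {v} (x , y , len , eq) =
  x , v ++ y , len , trans eq (cong (x ++_) (++-assoc u v y))

occursAt-++ʳ : OccursAt w (u ++ v) i → OccursAt w v (i + length u)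
occursAt-++ʳ {u = u} {v} (x , y , refl , eq) = x ++ u , y , length-++ x , (begin
  _                   ≡⟨ eq ⟩
  x ++ (u ++ v) ++ y  ≡⟨ cong (x ++_) (++-assoc u v y) ⟩
  x ++ u ++ v ++ y    ≡⟨ ++-assoc x u (v ++ y) ⟨
  (x ++ u) ++ v ++ y  ∎)
  where open ≡-Reasoning

occursAt-∷ : OccursAt w u i → OccursAt (c ∷ w) u (suc i)
occursAt-∷ {c = c} (x , y , refl , eq) = c ∷ x , y , refl , cong (c ∷_) eq

occursAt-∷⁻ : OccursAt (c ∷ w) u (suc i) → OccursAt w u i
occursAt-∷⁻ (_ ∷ x , y , len , eq) = x , y , suc-injective len , proj₂ (∷-injective eq)

occursAt-injective : OccursAt w u i → OccursAt w v i → length u ≡ length v → u ≡ v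
occursAt-injective (x , y , lx , eq) (x′ , y′ , lx′ , eq′) len =
  proj₁ (++-injective _ _ len (proj₂ (++-injective x x′ (trans lx (sym lx′)) (trans (sym eq) eq′))))

prefix⇒occursAt-0 : IsPrefix u w → OccursAt w u 0
prefix⇒occursAt-0 (y , eq) = [] , y , refl , eq

occursAt-0⇒prefix : OccursAt w u 0 → IsPrefix u w
occursAt-0⇒prefix ([] , y , _ , eq) = y , eq

suffix⇒occursAt-end : IsSuffix u w → ∃[ i ] (OccursAt w u i × i + length u ≡ length w)
suffix⇒occursAt-end {u = u} (x , eq) =
  length x , (x , [] , refl , trans eq (cong (x ++_) (sym (++-identityʳ u)))) ,
  sym (trans (cong length eq) (length-++ x))

occursAt-end⇒suffix : OccursAt w u i → i + length u ≡ length w → IsSuffix u w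
occursAt-end⇒suffix {u = u} (x , [] , refl , eq) _ = x , trans eq (cong (x ++_) (++-identityʳ u))
occursAt-end⇒suffix {u = u} (x , a ∷ y , refl , refl) end =
  ⊥-elim (m+1+n≰m _ (≤-reflexive (sym (trans end (length-++-++ x u (a ∷ y))))))

prefix-injective : IsPrefix u w → IsPrefix v w → length u ≡ length v → u ≡ v
prefix-injective pu pv = occursAt-injective (prefix⇒occursAt-0 pu) (prefix⇒occursAt-0 pv)

suffix-injective : IsSuffix u w → IsSuffix v w → length u ≡ length v → u ≡ v
suffix-injective {v = v} su sv len with suffix⇒occursAt-end su | suffix⇒occursAt-end sv
... | i , ou , eu | j , ov , ev = occursAt-injective ou (subst (OccursAt _ v) j≡i ov) len
  where
  j≡i : j ≡ i
  j≡i = +-cancelʳ-≡ (length v) j i (trans ev (trans (sym eu) (cong (i +_) len)))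

prefix-of-prefix : IsPrefix u w → IsPrefix v w → length u ≤ length v → IsPrefix u v
prefix-of-prefix {u = u} {v = v} (y , eq) (y′ , eq′) len
  with ++-split u v len (trans (sym eq) eq′)
... | z , e , _ = z , e

suffix-of-suffix : IsSuffix u w → IsSuffix v w → length u ≤ length v → IsSuffix u v
suffix-of-suffix {u = u} {w} {v} (x , eq) (x′ , eq′) len
  with ++-split x′ x (+-cancelʳ-≤ (length v) _ _ x′v≤xv) (trans (sym eq′) eq)
  where
  x′v≤xv : length x′ + length v ≤ length x + length v
  x′v≤xv = begin
    length x′ + length v  ≡⟨ length-++ x′ ⟨
    length (x′ ++ v)      ≡⟨ cong length (trans (sym eq′) eq) ⟩
    length (x ++ u)       ≡⟨ length-++ x ⟩
    length x + length u   ≤⟨ +-monoʳ-≤ (length x) len ⟩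
    length x + length v   ∎
    where open ≤-Reasoning
... | z , _ , e = z , e

suffix-∷ : IsSuffix u w → IsSuffix u (c ∷ w)
suffix-∷ {c = c} (x , eq) = c ∷ x , cong (c ∷_) eq

suffix-∷⁻ : IsSuffix u (c ∷ w) → length u ≤ length w → IsSuffix u w
suffix-∷⁻ ([]    , refl) len = ⊥-elim (<-irrefl refl len)
suffix-∷⁻ (_ ∷ x , eq)   _   = x , proj₂ (∷-injective eq)

suffix-∷-tail : IsSuffix (a ∷ u) (c ∷ w) → IsSuffix u w
suffix-∷-tail ([]    , eq) = [] , proj₂ (∷-injective eq)
suffix-∷-tail {a = a} {u = u} (_ ∷ x , eq) =
  x ++ [ a ] , trans (proj₂ (∷-injective eq)) (sym (++-assoc x [ a ] u))

repeats-∷ : Repeats w u → Repeats (c ∷ w) u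
repeats-∷ (i , j , i≢j , oi , oj) = suc i , suc j , i≢j ∘ suc-injective , occursAt-∷ oi , occursAt-∷ oj

repeats-∷-tail : Repeats (c ∷ w) (a ∷ u) → Repeats w u
repeats-∷-tail {a = a} (i , j , i≢j , oi , oj) =
  i , j , i≢j , tail oi , tail oj
  where
  tail : ∀ {k} → OccursAt _ (a ∷ _) k → OccursAt _ _ k
  tail {k} o = occursAt-∷⁻ (subst (OccursAt _ _) (+-comm k 1) (occursAt-++ʳ {u = [ a ]} o))

repeats⇒occursAt-suc : Repeats w u → ∃[ r ] OccursAt w u (suc r)
repeats⇒occursAt-suc (zero  , zero  , i≢j , _)      = ⊥-elim (i≢j refl)
repeats⇒occursAt-suc (zero  , suc j , _   , _ , oj) = j , oj
repeats⇒occursAt-suc (suc i , _     , _   , oi , _) = i , oi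

repeats⇒shorter : Repeats w u → length u < length w
repeats⇒shorter {w = w} {u = u} rep with repeats⇒occursAt-suc rep
... | r , o = m+n≤o⇒n≤o r (subst (_≤ length w) (sym (+-suc r (length u))) (occursAt-bound o))

lrs-∷-≤ : IsLRS (c ∷ w) s → IsLRS w s′ → length s′ ≤ length s
lrs-∷-≤ (_ , _ , max) (suf′ , rep′ , _) = max _ (suffix-∷ suf′) (repeats-∷ rep′)

lrs-∷-≤suc : IsLRS (c ∷ w) s → IsLRS w s′ → length s ≤ suc (length s′)
lrs-∷-≤suc {s = []}    _                  _             = z≤n
lrs-∷-≤suc {s = _ ∷ s} (suf , rep , _) (_ , _ , max′) =
  s≤s (max′ s (suffix-∷-tail suf) (repeats-∷-tail rep))

lrs-∷-≡ : IsLRS (c ∷ w) s → IsLRS w s′ → Repeats w s → s ≡ s′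
lrs-∷-≡ hs@(suf , _ , _) hs′@(suf′ , _ , max′) rep =
  suffix-injective suf (suffix-∷ suf′)
    (≤-antisym (max′ _ (suffix-∷⁻ suf (<⇒≤ (repeats⇒shorter rep))) rep) (lrs-∷-≤ hs hs′))

lrs-∷-grows : IsLRS (c ∷ w) s → IsLRS w s′ → s ≢ s′ → length s′ + 1 ≡ length s
lrs-∷-grows hs hs′ s≢s′ with m≤n⇒m<n∨m≡n (lrs-∷-≤ hs hs′)
... | inj₂ eq = ⊥-elim (s≢s′ (suffix-injective (proj₁ hs) (suffix-∷ (proj₁ hs′)) (sym eq)))
... | inj₁ lt = trans (+-comm _ 1) (≤-antisym lt (lrs-∷-≤suc hs hs′))

OccursOnlyAtEnds : List A → List A → Set
OccursOnlyAtEnds w u = ∀ k → OccursAt w u k → k ≡ 0 ⊎ k + length u ≡ length w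

¬repeats-tail⇒onlyAtEnds : IsSuffix u (c ∷ w) → ¬ Repeats w u → OccursOnlyAtEnds (c ∷ w) u
¬repeats-tail⇒onlyAtEnds _ _ zero _ = inj₁ refl
¬repeats-tail⇒onlyAtEnds {u = u} suf ¬rep (suc k) o with suffix⇒occursAt-end suf
... | zero , _ , end =
  ⊥-elim (m+n≮n k (length u) (subst (suc k + length u ≤_) (sym end) (occursAt-bound o)))
... | suc s , os , end with k ≟ s
...   | yes refl = inj₂ end
...   | no  k≢s  = ⊥-elim (¬rep (k , s , k≢s , occursAt-∷⁻ o , occursAt-∷⁻ os))

repeats-onlyAtEnds⇒prefix : Repeats w u → OccursOnlyAtEnds w u → IsPrefix u w
repeats-onlyAtEnds⇒prefix (i , j , i≢j , oi , oj) ends with ends i oi | ends j oj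
... | inj₁ refl | _         = occursAt-0⇒prefix oi
... | inj₂ _    | inj₁ refl = occursAt-0⇒prefix oj
... | inj₂ endᵢ | inj₂ endⱼ = ⊥-elim (i≢j (+-cancelʳ-≡ _ i j (trans endᵢ (sym endⱼ))))

onlyAtEnds⇒exactlyTwice : Repeats w u → OccursOnlyAtEnds w u → OccursExactlyTwice w u
onlyAtEnds⇒exactlyTwice {w = w} {u = u} rep ends with repeats⇒occursAt-suc rep
... | r , or = 0 , suc r , (λ ()) , prefix⇒occursAt-0 (repeats-onlyAtEnds⇒prefix rep ends) , or , only
  where
  only : ∀ k → OccursAt w u k → k ≡ 0 ⊎ k ≡ suc r
  only k ok with ends k ok | ends (suc r) or
  ... | inj₁ k≡0  | _         = inj₁ k≡0
  ... | inj₂ endₖ | inj₂ endᵣ = inj₂ (+-cancelʳ-≡ _ k (suc r) (trans endₖ (sym endᵣ)))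

lrp-onlyAtEnds : IsLRP w p → IsPrefix u w → Repeats w u → OccursOnlyAtEnds w u → u ≡ p
lrp-onlyAtEnds {w = w} {p = p} {u = u} (pp , rp , max) pu ru ends with repeats⇒occursAt-suc rp
... | q , oq with prefix-of-prefix pu pp (max u pu ru)
...   | z , refl with ends (suc q) (occursAt-++ˡ oq)
...     | inj₂ end = prefix-injective pu pp (≤-antisym (max u pu ru) p≤u)
  where
  p≤u : length p ≤ length u
  p≤u = +-cancelˡ-≤ (suc q) _ _ (subst (suc q + length p ≤_) (sym end) (occursAt-bound oq))

onlyAtEnds⇒extensions-initial : OccursOnlyAtEnds w u → IsPrefix u v → OccursAt w (v ++ [ a ]) i → i ≡ 0
onlyAtEnds⇒extensions-initial {w = w} {u = u} {a = a} {i = i} ends (z , refl) o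
  with ends i (occursAt-++ˡ (subst (λ t → OccursAt w t i) (++-assoc u z [ a ]) o))
... | inj₁ i≡0 = i≡0
... | inj₂ end = ⊥-elim (<-irrefl end (<-≤-trans (+-monoʳ-< i u<) (occursAt-bound o)))
  where
  u< : length u < length ((u ++ z) ++ [ a ])
  u< = subst (length u <_) (sym (length-++-comm (u ++ z) [ a ])) (s≤s (length-++-≤ˡ u))

initial-extensions⇒¬branching : (∀ a i → OccursAt w (v ++ [ a ]) i → i ≡ 0) → ¬ IsBranching w v
initial-extensions⇒¬branching {w = w} {v = v} initial (a , b , a≢b , (i , oa) , (j , ob)) =
  a≢b (proj₁ (∷-injective (++-cancelˡ v _ _ (occursAt-injective (at0 oa) (at0 ob) (trans (length-++ v) (sym (length-++ v)))))))
  where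
  at0 : ∀ {a k} → OccursAt w (v ++ [ a ]) k → OccursAt w (v ++ [ a ]) 0
  at0 {a} {k} o = subst (OccursAt w _) (initial a k o) o

leaf-prefix : IsLeaf w v → IsPrefix v w → v ≡ w
leaf-prefix {v = v} _            ([]    , eq) = sym (trans eq (++-identityʳ v))
leaf-prefix {v = v} (_ , noExt) (a ∷ y , eq) =
  ⊥-elim (noExt a (0 , [] , y , refl , trans eq (sym (++-assoc v [ a ] y))))

whole-isLeaf : IsLeaf w w
whole-isLeaf {w = w} = (0 , [] , [] , refl , sym (++-identityʳ w)) , λ a (k , o) →
  m+1+n≰m (length w) (subst (_≤ length w) (length-++ w) (m+n≤o⇒n≤o k (occursAt-bound o)))

leafEdge-intro : u ≢ [] → IsPrefix u w → length u < length w → OccursOnlyAtEnds w u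
               → LocusOnLeafEdgeOfW w u
leafEdge-intro {u = u} {w = w} u≢[] pu u<w ends =
  (0 , prefix⇒occursAt-0 pu) , ¬node , inj₂ (inj₂ whole-isLeaf) , pu ,
  (λ u≡w → <-irrefl (cong length u≡w) u<w) , onEdge
  where
  ¬branching : ∀ {v} → IsPrefix u v → ¬ IsBranching w v
  ¬branching pv = initial-extensions⇒¬branching (λ _ _ → onlyAtEnds⇒extensions-initial ends pv)

  ¬node : ¬ IsNode w u
  ¬node (inj₁ u≡[])        = u≢[] u≡[]
  ¬node (inj₂ (inj₁ br))   = ¬branching ([] , sym (++-identityʳ u)) br
  ¬node (inj₂ (inj₂ leaf)) = <-irrefl (cong length (leaf-prefix leaf pu)) u<w

  onEdge : ∀ v → IsNode w v → IsPrefix u v → IsPrefix v w → v ≡ w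
  onEdge _ (inj₁ refl)        (z , eq) _  = ⊥-elim (u≢[] (++-conicalˡ u z (sym eq)))
  onEdge _ (inj₂ (inj₁ br))   pv       _  = ⊥-elim (¬branching pv br)
  onEdge _ (inj₂ (inj₂ leaf)) _        pw = leaf-prefix leaf pw

leafEdge⇒lrp-¬branching : LocusOnLeafEdgeOfW w u → Repeats w u → IsLRP w p → ¬ IsBranching w p
leafEdge⇒lrp-¬branching {p = p} (_ , _ , _ , pu , _ , onEdge) ru (pp , rp , max) br =
  <-irrefl (cong length (onEdge p (inj₂ (inj₁ br)) (prefix-of-prefix pu pp (max _ pu ru)) pp))
           (repeats⇒shorter rp)

lrp-¬branching⇒late-final : IsLRP w p → ¬ IsBranching w p → OccursAt w p (suc r)
                          → suc r + length p ≡ length w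
lrp-¬branching⇒late-final {p = p} {r = r} (pp , _ , max) ¬br o with m≤n⇒m<n∨m≡n (occursAt-bound o)
... | inj₂ end  = end
... | inj₁ room with occursAt-extend o room
                   | occursAt-extend (prefix⇒occursAt-0 pp) (≤-<-trans (m≤n+m (length p) (suc r)) room)
...   | b , ob | a , oa = ⊥-elim (¬br (a , b , a≢b , (0 , oa) , (suc r , ob)))
  where
  a≢b : a ≢ b
  a≢b refl = m+1+n≰m (length p)
    (subst (_≤ length p) (length-++ p) (max _ (occursAt-0⇒prefix oa) (0 , suc r , (λ ()) , oa , ob)))

lrp-¬branching⇒¬repeats-tail : IsLRS (c ∷ w) s → IsLRP (c ∷ w) p → ¬ IsBranching (c ∷ w) p
                             → ¬ Repeats w s
lrp-¬branching⇒¬repeats-tail {c = c} {w = w} {p = p} (sufS , _ , maxS) hp@(_ , rp , _) ¬br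
                             (a , b , a≢b , oa , ob) with repeats⇒occursAt-suc rp
... | q , oq with occursAt-end⇒suffix oq (lrp-¬branching⇒late-final hp ¬br oq)
...   | sufP with suffix-of-suffix sufP sufS (maxS p sufP rp)
...     | z , refl =
  a≢b (+-cancelʳ-≡ (length z) a b (suc-injective (+-cancelʳ-≡ (length p) _ _ (trans (end oa) (sym (end ob))))))
  where
  end : ∀ {k} → OccursAt w (z ++ p) k → suc (k + length z) + length p ≡ length (c ∷ w)
  end o = lrp-¬branching⇒late-final hp ¬br (occursAt-++ʳ (occursAt-∷ o))

pigeonhole-0-suc : m ≢ n → (0 ≡ i ⊎ 0 ≡ j) → (suc m ≡ i ⊎ suc m ≡ j) → (suc n ≡ i ⊎ suc n ≡ j) → ⊥
pigeonhole-0-suc _   (inj₁ refl) (inj₁ ())   _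
pigeonhole-0-suc _   (inj₁ refl) (inj₂ refl) (inj₁ ())
pigeonhole-0-suc m≢n (inj₁ refl) (inj₂ refl) (inj₂ e)    = m≢n (sym (suc-injective e))
pigeonhole-0-suc m≢n (inj₂ refl) (inj₁ refl) (inj₁ e)    = m≢n (sym (suc-injective e))
pigeonhole-0-suc _   (inj₂ refl) (inj₁ refl) (inj₂ ())
pigeonhole-0-suc _   (inj₂ refl) (inj₂ ())   _

exactlyTwice-prefix⇒¬repeats-tail : OccursExactlyTwice (c ∷ w) u → IsPrefix u (c ∷ w) → ¬ Repeats w u
exactlyTwice-prefix⇒¬repeats-tail (_ , _ , _ , _ , _ , only) pu (a , b , a≢b , oa , ob) =
  pigeonhole-0-suc a≢b (only 0 (prefix⇒occursAt-0 pu)) (only _ (occursAt-∷ oa)) (only _ (occursAt-∷ ob))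

lemma3 : {A : Set} (c : A) (W′ lrs lrs′ lrp : List A)
    → IsLRS (c ∷ W′) lrs → IsLRS W′ lrs′ → IsLRP (c ∷ W′) lrp → lrp ≢ []
    → ((lrs ≢ lrs′) ⇔ (lrs ≡ lrp × OccursExactlyTwice (c ∷ W′) lrs))
    × ((lrs ≢ lrs′) ⇔ ((∃[ x ] (c ∷ W′) ≡ x ++ lrs′) × length lrs′ + 1 ≡ length lrs))
    × ((lrs ≢ lrs′) ⇔ LocusOnLeafEdgeOfW (c ∷ W′) lrp)
    × ((lrs ≢ lrs′) ⇔ LocusOnLeafEdgeOfW (c ∷ W′) lrs)
lemma3 {A} c W′ S S′ P hS@(sufS , repS , _) hS′@(sufS′ , repS′ , _) hP@(preP , repP , _) P≢[] =
    mk⇔ (λ S≢S′ → lrs≡lrp S≢S′ , onlyAtEnds⇒exactlyTwice repS (lrs-ends S≢S′))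
        (λ (S≡P , twice) → ≢-of-¬repeats
          (exactlyTwice-prefix⇒¬repeats-tail twice (subst (λ t → IsPrefix t W) (sym S≡P) preP)))
  , mk⇔ (λ S≢S′ → suffix-∷ sufS′ , lrs-∷-grows hS hS′ S≢S′)
        (λ (_ , grows) S≡S′ → m+1+n≰m (length S′) (≤-reflexive (trans grows (cong length S≡S′))))
  , mk⇔ (λ S≢S′ → subst (LocusOnLeafEdgeOfW W) (lrs≡lrp S≢S′) (lrs-leafEdge S≢S′)) (≢-of-leafEdge repP)
  , mk⇔ lrs-leafEdge (≢-of-leafEdge repS)
  where
  W : List A
  W = c ∷ W′

  ≢-of-¬repeats : ¬ Repeats W′ S → S ≢ S′
  ≢-of-¬repeats ¬rep S≡S′ = ¬rep (subst (Repeats W′) (sym S≡S′) repS′)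

  ≢-of-leafEdge : ∀ {u} → Repeats W u → LocusOnLeafEdgeOfW W u → S ≢ S′
  ≢-of-leafEdge rep edge =
    ≢-of-¬repeats (lrp-¬branching⇒¬repeats-tail hS hP (leafEdge⇒lrp-¬branching edge rep hP))

  lrs-ends : S ≢ S′ → OccursOnlyAtEnds W S
  lrs-ends S≢S′ = ¬repeats-tail⇒onlyAtEnds sufS (S≢S′ ∘ lrs-∷-≡ hS hS′)

  lrs-prefix : S ≢ S′ → IsPrefix S W
  lrs-prefix S≢S′ = repeats-onlyAtEnds⇒prefix repS (lrs-ends S≢S′)

  lrs≡lrp : S ≢ S′ → S ≡ P
  lrs≡lrp S≢S′ = lrp-onlyAtEnds hP (lrs-prefix S≢S′) repS (lrs-ends S≢S′)

  lrs-leafEdge : S ≢ S′ → LocusOnLeafEdgeOfW W S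
  lrs-leafEdge S≢S′ =
    leafEdge-intro (P≢[] ∘ trans (sym (lrs≡lrp S≢S′))) (lrs-prefix S≢S′) (repeats⇒shorter repS) (lrs-ends S≢S′)
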